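{- Let $G$ be a simple 2-connected graph of order $n\ge 5$. If $G$ is $\{K_{1,3}, P_4\}$-free, then $G$ is chorded pancyclic.
   Context: $G$ is $\{H_1,\dots,H_r\}$-free if $G$ contains no induced subgraph isomorphic to any $H_i$. $K_{1,3}$ is the claw and $P_t$ denotes the path on $t$ vertices. A chorded cycle is a cycle $C$ such that $G$ has an edge joining two vertices nonconsecutive on $C$. A graph $G$ of order $n$ is chorded pancyclic if it contains a chorded cycle of every length $m$ with $4\le m\le n$. -}

module Defs where

open import Data.Nat using (ℕ; zero; suc; _≤_; _∸_)
open import Data.Fin using (Fin; toℕ)
open import Data.Bool using (Bool; true; false)
open import Data.Product using (Σ; ∃; _×_; _,_)
open import Data.Sum using (_⊎_)
open import Data.Unit using (⊤)
open import Relation.Nullary using (¬_)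
open import Relation.Binary.PropositionalEquality using (_≡_; _≢_)
open import Function.Definitions using (Injective)

record Graph (n : ℕ) : Set where
  field
    adj   : Fin n → Fin n → Bool
    sym   : ∀ u v → adj u v ≡ adj v u
    irrefl : ∀ v → adj v v ≡ false
open Graph public

InducedSub : ∀ {k n} → Graph k → Graph n → Set
InducedSub {k} {n} H G =
  Σ (Fin k → Fin n) λ f →
    Injective _≡_ _≡_ f × (∀ i j → adj G (f i) (f j) ≡ adj H i j)

Free : ∀ {k n} → Graph k → Graph n → Set
Free H G = ¬ InducedSub H G

clawAdj : Fin 4 → Fin 4 → Bool
clawAdj Fin.zero Fin.zero = false
clawAdj Fin.zero (Fin.suc _) = true
clawAdj (Fin.suc _) Fin.zero = true
clawAdj (Fin.suc _) (Fin.suc _) = false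

claw : Graph 4
claw = record { adj = clawAdj ; sym = s ; irrefl = r }
  where
  s : ∀ u v → clawAdj u v ≡ clawAdj v u
  s Fin.zero Fin.zero = Relation.Binary.PropositionalEquality.refl
  s Fin.zero (Fin.suc _) = Relation.Binary.PropositionalEquality.refl
  s (Fin.suc _) Fin.zero = Relation.Binary.PropositionalEquality.refl
  s (Fin.suc _) (Fin.suc _) = Relation.Binary.PropositionalEquality.refl
  r : ∀ v → clawAdj v v ≡ false
  r Fin.zero = Relation.Binary.PropositionalEquality.refl
  r (Fin.suc _) = Relation.Binary.PropositionalEquality.refl

-- The path P_4: 0 - 1 - 2 - 3 (adjacent iff indices differ by exactly 1).
diff1 : ℕ → ℕ → Bool
diff1 (suc a) (suc b) = diff1 a b
diff1 zero zero = false
diff1 zero (suc zero) = true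
diff1 zero (suc (suc _)) = false
diff1 (suc zero) zero = true
diff1 (suc (suc _)) zero = false

diff1-sym : ∀ a b → diff1 a b ≡ diff1 b a
diff1-sym zero zero = Relation.Binary.PropositionalEquality.refl
diff1-sym zero (suc zero) = Relation.Binary.PropositionalEquality.refl
diff1-sym zero (suc (suc b)) = Relation.Binary.PropositionalEquality.refl
diff1-sym (suc zero) zero = Relation.Binary.PropositionalEquality.refl
diff1-sym (suc (suc a)) zero = Relation.Binary.PropositionalEquality.refl
diff1-sym (suc a) (suc b) = diff1-sym a b

diff1-irr : ∀ a → diff1 a a ≡ false
diff1-irr zero = Relation.Binary.PropositionalEquality.refl
diff1-irr (suc a) = diff1-irr a

P4 : Graph 4
P4 = record
  { adj = λ i j → diff1 (toℕ i) (toℕ j)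
  ; sym = λ i j → diff1-sym (toℕ i) (toℕ j)
  ; irrefl = λ i → diff1-irr (toℕ i) }

data WalkIn {n : ℕ} (G : Graph n) (S : Fin n → Set) : Fin n → Fin n → Set where
  nil  : ∀ {u} → S u → WalkIn G S u u
  cons : ∀ {u v w} → S u → adj G u v ≡ true → WalkIn G S v w → WalkIn G S u w

Connected : ∀ {n} → Graph n → Set
Connected G = ∀ u w → WalkIn G (λ _ → ⊤) u w

-- 2-connected: more than 2 vertices, connected, and G - v connected for all v.
TwoConnected : ∀ {n} → Graph n → Set
TwoConnected {n} G =
  3 ≤ n × Connected G ×
  (∀ v u w → u ≢ v → w ≢ v → WalkIn G (λ x → x ≢ v) u w)

CycSucc : ∀ {m} → Fin m → Fin m → Set
CycSucc {m} i j =
  toℕ j ≡ suc (toℕ i) ⊎ (toℕ i ≡ m ∸ 1 × toℕ j ≡ 0)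

CycConsec : ∀ {m} → Fin m → Fin m → Set
CycConsec i j = CycSucc i j ⊎ CycSucc j i

Cycle : ∀ {n} → Graph n → ℕ → Set
Cycle {n} G m =
  3 ≤ m × Σ (Fin m → Fin n) λ c →
    Injective _≡_ _≡_ c × (∀ i j → CycSucc i j → adj G (c i) (c j) ≡ true)

ChordedCycle : ∀ {n} → Graph n → ℕ → Set
ChordedCycle {n} G m =
  3 ≤ m × Σ (Fin m → Fin n) λ c →
    Injective _≡_ _≡_ c × (∀ i j → CycSucc i j → adj G (c i) (c j) ≡ true) ×
    Σ (Fin m) λ i → Σ (Fin m) λ j →
      i ≢ j × ¬ CycConsec i j × adj G (c i) (c j) ≡ true

ChordedPancyclic : ∀ {n} → Graph n → Set
ChordedPancyclic {n} G = ∀ m → 4 ≤ m → m ≤ n → ChordedCycle G m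

module Submission where

-- A cycle C of length m < n can be lengthened by one vertex. Take x outside C adjacent to some
-- v on C. If x cannot be inserted next to v, claw-freeness at v makes the two neighbours of v
-- on C adjacent, and P4-freeness then lets x be inserted further along C unless v is adjacent
-- to every other vertex of C and x to none of them: C is a wheel with hub v. In that case a
-- path from x to C avoiding v enters C at some t ≠ v from a vertex y; the same dichotomy at t,
-- and P4-freeness on x v t y, force x ~ y, and v x y followed by the rim from t minus one
-- vertex is a cycle of length m + 1. Starting from a triangle or a square this gives cycles of
-- every length 4 ≤ m ≤ n. P4-freeness on four consecutive vertices puts a chord in every cycle
-- of length at least 5, and every pentagon contains a diamond, i.e. a chorded 4-cycle.

open import Defs
open import Data.Nat using (ℕ; zero; suc; _+_; _≤_; _<_; z≤n; s≤s)
open import Data.Nat.Properties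
  using (≤-trans; ≤-refl; <⇒≤; ≤-pred; n≤1+n; n≮n; m≤m+n; m+n≤o⇒n≤o; suc-injective;
         m≤n⇒m<n∨m≡n)
open import Data.Fin using (Fin; toℕ; zero; suc)
open import Data.Fin.Patterns using (0F; 1F; 2F; 3F)
open import Data.Fin.Properties using (pigeonhole; ¬∀⟶∃¬) renaming (_≟_ to _≟ᶠ_)
open import Data.Bool using (true)
open import Data.Bool.Properties using (¬-not) renaming (_≟_ to _≟ᵇ_)
open import Data.Product using (Σ-syntax; ∃-syntax; _×_; _,_; proj₁; proj₂)
open import Data.Sum using (_⊎_; inj₁; inj₂)
open import Data.List using (List; []; _∷_; [_]; _++_; _∷ʳ_; length; lookup)
open import Data.List.Relation.Unary.All as All using (All; []; _∷_)
open import Data.List.Relation.Unary.All.Properties using (¬Any⇒All¬)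
open import Data.List.Relation.Unary.AllPairs as AllPairs using ([]; _∷_)
open import Data.List.Relation.Unary.Any using (here; there; index)
open import Data.List.Relation.Unary.Any.Properties using (lookup-index)
open import Data.List.Relation.Unary.Unique.Propositional using (Unique)
open import Data.List.Membership.Propositional using (_∈_; _∉_)
open import Data.List.Membership.Propositional.Properties using (∈-lookup)
import Data.List.Membership.DecPropositional as DecMembership
open import Data.List.Relation.Binary.Permutation.Propositional
  using (_↭_; ↭-refl; ↭-sym; ↭-trans; prep; swap; ↭⇒↭ₛ)
open import Data.List.Relation.Binary.Permutation.Propositional.Properties
  using (∈-resp-↭; ↭-length; ++-comm; shift; ∷↭∷ʳ)
import Data.List.Relation.Binary.Permutation.Setoid.Properties as SetoidPermutation
open import Relation.Nullary using (¬_; Dec; yes; no; contradiction)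
open import Relation.Binary.PropositionalEquality as ≡
  using (_≡_; _≢_; ≢-sym; refl; cong; subst)
open import Relation.Binary.PropositionalEquality.Properties using (setoid)

Unique-resp-↭ : ∀ {A : Set} {xs ys : List A} → xs ↭ ys → Unique xs → Unique ys
Unique-resp-↭ {A} p = SetoidPermutation.Unique-resp-↭ (setoid A) (↭⇒↭ₛ p)

∉-resp-↭ : ∀ {A : Set} {x : A} {xs ys} → xs ↭ ys → x ∉ xs → x ∉ ys
∉-resp-↭ p x∉ x∈ = x∉ (∈-resp-↭ (↭-sym p) x∈)

fresh∷ : ∀ {A : Set} {x : A} {xs} → x ∉ xs → Unique xs → Unique (x ∷ xs)
fresh∷ x∉ u = ¬Any⇒All¬ _ x∉ ∷ u

lookup-injective : ∀ {A : Set} {xs : List A} → Unique xs →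
                   ∀ {i j} → lookup xs i ≡ lookup xs j → i ≡ j
lookup-injective (x≢ ∷ u) {zero}  {zero}  e = refl
lookup-injective (x≢ ∷ u) {zero}  {suc j} e = contradiction e (All.lookup x≢ (∈-lookup j))
lookup-injective (x≢ ∷ u) {suc i} {zero}  e = contradiction (≡.sym e) (All.lookup x≢ (∈-lookup i))
lookup-injective (x≢ ∷ u) {suc i} {suc j} e = cong suc (lookup-injective u e)

length<⇒∃∉ : ∀ {n} (xs : List (Fin n)) → length xs < n → ∃[ z ] z ∉ xs
length<⇒∃∉ {n} xs <n = ¬∀⟶∃¬ n (_∈ xs) (λ z → DecMembership._∈?_ _≟ᶠ_ z xs) all∈
  where
  all∈ : ¬ (∀ z → z ∈ xs)
  all∈ z∈ with pigeonhole <n (λ z → index (z∈ z))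
  ... | i , j , i<j , same-index = n≮n (toℕ j) (subst (λ k → toℕ k < toℕ j) i≡j i<j)
    where
    i≡j : i ≡ j
    i≡j = ≡.trans (lookup-index (z∈ i))
                  (≡.trans (cong (lookup xs) same-index) (≡.sym (lookup-index (z∈ j))))

nonconsecutive : ∀ {m} {i j : Fin m} → 2 + toℕ i ≤ toℕ j → suc (toℕ j) < m → ¬ CycConsec i j
nonconsecutive i+2≤j _ (inj₁ (inj₁ j≡i+1)) = n≮n _ (subst (2 + _ ≤_) j≡i+1 i+2≤j)
nonconsecutive i+2≤j _ (inj₁ (inj₂ (_ , j≡0))) = contradiction (subst (2 + _ ≤_) j≡0 i+2≤j) λ ()
nonconsecutive i+2≤j _ (inj₂ (inj₁ i≡j+1)) =
  n≮n _ (m+n≤o⇒n≤o 2 (subst (λ k → 2 + k ≤ _) i≡j+1 i+2≤j))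
nonconsecutive {suc m} _ j+2≤m (inj₂ (inj₂ (j≡m , _))) =
  n≮n _ (subst (λ k → suc k < suc m) j≡m j+2≤m)

module _ {n : ℕ} (G : Graph n) where

  V : Set
  V = Fin n

  infix 4 _~_ _≁_ _~?_

  _~_ _≁_ : V → V → Set
  u ~ v = adj G u v ≡ true
  u ≁ v = ¬ (u ~ v)

  _~?_ : ∀ u v → Dec (u ~ v)
  u ~? v = adj G u v ≟ᵇ true

  ~-sym : ∀ {u v} → u ~ v → v ~ u
  ~-sym {u} {v} uv = ≡.trans (Graph.sym G v u) uv

  ≁-sym : ∀ {u v} → u ≁ v → v ≁ u
  ≁-sym u≁v vu = u≁v (~-sym vu)

  ~⇒≢ : ∀ {u v} → u ~ v → u ≢ v
  ~⇒≢ {u} uu refl = contradiction (≡.trans (≡.sym uu) (irrefl G u)) λ ()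

  ~≁⇒≢ : ∀ {u v w} → u ~ w → v ≁ w → u ≢ v
  ~≁⇒≢ uw v≁w refl = v≁w uw

  embed₄ : (H : Graph 4) {a b c d : V} → Unique (a ∷ b ∷ c ∷ d ∷ []) →
           adj G a b ≡ adj H 0F 1F → adj G a c ≡ adj H 0F 2F → adj G a d ≡ adj H 0F 3F →
           adj G b c ≡ adj H 1F 2F → adj G b d ≡ adj H 1F 3F → adj G c d ≡ adj H 2F 3F →
           InducedSub H G
  embed₄ H {a} {b} {c} {d} u ab ac ad bc bd cd = f , lookup-injective u , agree
    where
    f : Fin 4 → V
    f = lookup (a ∷ b ∷ c ∷ d ∷ [])
    diag : ∀ i → adj G (f i) (f i) ≡ adj H i i
    diag i = ≡.trans (irrefl G (f i)) (≡.sym (irrefl H i))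
    flip : ∀ {i j} → adj G (f i) (f j) ≡ adj H i j → adj G (f j) (f i) ≡ adj H j i
    flip {i} {j} e = ≡.trans (Graph.sym G (f j) (f i)) (≡.trans e (Graph.sym H i j))
    agree : ∀ i j → adj G (f i) (f j) ≡ adj H i j
    agree 0F 0F = diag 0F
    agree 0F 1F = ab
    agree 0F 2F = ac
    agree 0F 3F = ad
    agree 1F 0F = flip ab
    agree 1F 1F = diag 1F
    agree 1F 2F = bc
    agree 1F 3F = bd
    agree 2F 0F = flip ac
    agree 2F 1F = flip bc
    agree 2F 2F = diag 2F
    agree 2F 3F = cd
    agree 3F 0F = flip ad
    agree 3F 1F = flip bd
    agree 3F 2F = flip cd
    agree 3F 3F = diag 3F

  -- Cycles as lists of vertices

  -- The index lists the vertices after the starting one.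
  data Walk : V → List V → V → Set where
    stop : ∀ {a} → Walk a [] a
    step : ∀ {a b vs c} → a ~ b → Walk b vs c → Walk a (b ∷ vs) c

  append : ∀ {a vs b c ws d} → Walk a vs b → b ~ c → Walk c ws d → Walk a (vs ++ c ∷ ws) d
  append stop        bc w′ = step bc w′
  append (step ab w) bc w′ = step ab (append w bc w′)

  last∈ : ∀ {a vs b} → Walk a vs b → b ∈ a ∷ vs
  last∈ stop       = here refl
  last∈ (step _ w) = there (last∈ w)

  split : ∀ {a vs b c} → Walk a vs b → c ∈ vs →
          Σ[ pre ∈ List V ] Σ[ post ∈ List V ] Σ[ q ∈ V ]
            vs ≡ pre ++ c ∷ post × Walk a pre q × q ~ c × Walk c post b
  split (step ac w) (here refl) = [] , _ , _ , refl , stop , ac , w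
  split (step ab w) (there c∈) with split w c∈
  ... | pre , post , q , refl , w₁ , qc , w₂ = _ ∷ pre , post , q , refl , step ab w₁ , qc , w₂

  unsnoc : ∀ {a c vs b} → Walk a (c ∷ vs) b →
           Σ[ us ∈ List V ] Σ[ e ∈ V ] Walk a us e × e ~ b × c ∷ vs ≡ us ∷ʳ b
  unsnoc (step ac stop) = [] , _ , stop , ac , refl
  unsnoc (step ac w@(step _ _)) with unsnoc w
  ... | us , e , w′ , eb , eq = _ ∷ us , e , step ac w′ , eb , cong (_ ∷_) eq

  data Loop (a : V) (vs : List V) : Set where
    close : ∀ {b} → Walk a vs b → b ~ a → Loop a vs

  rotate : ∀ {a vs c} → Loop a vs → c ∈ a ∷ vs → Σ[ ws ∈ List V ] Loop c ws × c ∷ ws ↭ a ∷ vs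
  rotate C (here refl) = _ , C , ↭-refl
  rotate {a} {c = c} (close w ba) (there c∈) with split w c∈
  ... | pre , post , q , refl , w₁ , qc , w₂ =
    _ , close (append w₂ ba w₁) qc , ++-comm (c ∷ post) (a ∷ pre)

  Tour : List V → Set
  Tour ks = Σ[ a ∈ V ] Σ[ vs ∈ List V ] Loop a vs × a ∷ vs ↭ ks

  Tour-resp-↭ : ∀ {ks ls} → ks ↭ ls → Tour ks → Tour ls
  Tour-resp-↭ q (a , vs , C , p) = a , vs , C , ↭-trans p q

  record ListCycle (m : ℕ) : Set where
    constructor cycle
    field
      {root} : V
      {rest} : List V
      loop   : Loop root rest
      unique : Unique (root ∷ rest)
      size   : suc (length rest) ≡ m

  Tour⇒ListCycle : ∀ {ks m} → Tour ks → Unique ks → length ks ≡ m → ListCycle m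
  Tour⇒ListCycle (_ , _ , C , p) u size =
    cycle C (Unique-resp-↭ (↭-sym p) u) (≡.trans (↭-length p) size)

  Wheel : V → List V → Set
  Wheel hub rim = Tour rim × All (hub ~_) rim

  -- v, x, y, then around the rim from t, skipping the rim vertex just before t, back to the hub.
  wheel-detour : ∀ {v ws x y t} → Wheel v ws → t ∈ ws → 2 ≤ length ws → Unique (v ∷ ws) →
                 v ~ x → x ~ y → y ~ t → x ∉ v ∷ ws → y ∉ v ∷ ws →
                 ListCycle (suc (length (v ∷ ws)))
  wheel-detour {v} {ws} {x} {y} {t} ((_ , _ , rim , p) , spokes) t∈ 2≤ (v∉ ∷ u) vx xy yt x∉ y∉
    with rotate rim (∈-resp-↭ (↭-sym p) t∈)
  ... | [] , _ , q = contradiction (subst (2 ≤_) (≡.sym (↭-length (↭-trans q p))) 2≤) λ { (s≤s ()) }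
  ... | _ ∷ _ , close {e} w _ , q with unsnoc w
  ... | us , _ , w′ , _ , eq =
    cycle (close (step vx (step xy (step yt w′))) (~-sym (All.lookup spokes (inWs (last∈ w′)))))
          (fresh∷ v∉′ (fresh∷ x∉′ (fresh∷ (λ y∈ → y∉ (there (inWs y∈))) tus-unique)))
          (cong (λ k → suc (suc k)) (↭-length π))
    where
    π : e ∷ t ∷ us ↭ ws
    π = ↭-trans (∷↭∷ʳ e (t ∷ us)) (subst (λ zs → t ∷ zs ↭ ws) eq (↭-trans q p))
    inWs : ∀ {z} → z ∈ t ∷ us → z ∈ ws
    inWs z∈ = ∈-resp-↭ π (there z∈)
    tus-unique : Unique (t ∷ us)
    tus-unique = AllPairs.tail (Unique-resp-↭ (↭-sym π) u)
    x∉′ : x ∉ y ∷ t ∷ us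
    x∉′ (here x≡y) = ~⇒≢ xy x≡y
    x∉′ (there x∈) = x∉ (there (inWs x∈))
    v∉′ : v ∉ x ∷ y ∷ t ∷ us
    v∉′ (here v≡x)         = ~⇒≢ vx v≡x
    v∉′ (there (here v≡y)) = y∉ (here (≡.sym v≡y))
    v∉′ (there (there v∈)) = All.lookup v∉ (inWs v∈) refl

  data Crossing (S : V → Set) (L : List V) : Set where
    crossing : ∀ {x t} → x ∉ L → t ∈ L → x ~ t → S t → Crossing S L

  WalkIn-start : ∀ {S a b} → WalkIn G S a b → S a
  WalkIn-start (nil s)      = s
  WalkIn-start (cons s _ _) = s

  first-crossing : ∀ {S a b} (L : List V) → WalkIn G S a b → a ∉ L → b ∈ L → Crossing S L
  first-crossing L (nil _) a∉ b∈ = contradiction b∈ a∉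
  first-crossing L (cons {v = c} _ ac w) a∉ b∈ with DecMembership._∈?_ _≟ᶠ_ c L
  ... | yes c∈ = crossing a∉ c∈ ac (WalkIn-start w)
  ... | no c∉  = first-crossing L w c∉ b∈

  walk-lookup : ∀ {a vs b} → Walk a vs b → (i j : Fin (suc (length vs))) →
                toℕ j ≡ suc (toℕ i) → lookup (a ∷ vs) i ~ lookup (a ∷ vs) j
  walk-lookup (step ab w) zero    (suc zero)    _ = ab
  walk-lookup (step ab w) (suc i) (suc j)       e = walk-lookup w i j (suc-injective e)
  walk-lookup (step ab w) zero    (suc (suc j)) ()
  walk-lookup (step ab w) (suc i) zero          ()
  walk-lookup stop        zero    zero          ()

  walk-lookup-last : ∀ {a vs b} → Walk a vs b → (i : Fin (suc (length vs))) →
                     toℕ i ≡ length vs → lookup (a ∷ vs) i ≡ b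
  walk-lookup-last stop       zero    _ = refl
  walk-lookup-last (step _ w) (suc i) e = walk-lookup-last w i (suc-injective e)
  walk-lookup-last (step _ w) zero    ()

  loop⇒chordedCycle : ∀ {a vs} → Loop a vs → Unique (a ∷ vs) → (i j : Fin (suc (length vs))) →
                      2 + toℕ i ≤ toℕ j → suc (toℕ j) < suc (length vs) →
                      lookup (a ∷ vs) i ~ lookup (a ∷ vs) j → ChordedCycle G (suc (length vs))
  loop⇒chordedCycle {a} {vs} (close w ba) u i j i+2≤j j+2≤m ij =
    3≤m , lookup (a ∷ vs) , lookup-injective u , successive ,
    i , j , (λ i≡j → ~⇒≢ ij (cong (lookup (a ∷ vs)) i≡j)) , nonconsecutive i+2≤j j+2≤m , ij
    where
    3≤m : 3 ≤ suc (length vs)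
    3≤m = ≤-trans (s≤s (≤-trans (m≤m+n 2 (toℕ i)) i+2≤j)) (<⇒≤ j+2≤m)
    successive : ∀ k l → CycSucc k l → lookup (a ∷ vs) k ~ lookup (a ∷ vs) l
    successive k l    (inj₁ l≡k+1)       = walk-lookup w k l l≡k+1
    successive k zero (inj₂ (k≡last , _)) =
      subst (_~ a) (≡.sym (walk-lookup-last w k k≡last)) ba

  triangle : ∀ {a b c} → a ~ b → b ~ c → c ~ a → ListCycle 3
  triangle ab bc ca =
    cycle (close (step ab (step bc stop)) ca)
          ((~⇒≢ ab ∷ ~⇒≢ (~-sym ca) ∷ []) ∷ (~⇒≢ bc ∷ []) ∷ [] ∷ []) refl

  square-unique : ∀ {a b c d} → a ~ b → b ~ c → c ~ d → d ~ a → a ≢ c → b ≢ d →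
                  Unique (a ∷ b ∷ c ∷ d ∷ [])
  square-unique ab bc cd da a≢c b≢d =
    (~⇒≢ ab ∷ a≢c ∷ ~⇒≢ (~-sym da) ∷ []) ∷ (~⇒≢ bc ∷ b≢d ∷ []) ∷ (~⇒≢ cd ∷ []) ∷ [] ∷ []

  square : ∀ {a b c d} → a ~ b → b ~ c → c ~ d → d ~ a → a ≢ c → b ≢ d → ListCycle 4
  square ab bc cd da a≢c b≢d =
    cycle (close (step ab (step bc (step cd stop))) da) (square-unique ab bc cd da a≢c b≢d) refl

  diamond : ∀ {a b c d} → a ~ b → b ~ c → c ~ d → d ~ a → b ≢ d → a ~ c → ChordedCycle G 4
  diamond ab bc cd da b≢d ac =
    loop⇒chordedCycle (close (step ab (step bc (step cd stop))) da)
                      (square-unique ab bc cd da (~⇒≢ ac) b≢d) 0F 2F ≤-refl ≤-refl ac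

  record Pentagon (a b c d e : V) : Set where
    constructor pentagon
    field
      ab : a ~ b
      bc : b ~ c
      cd : c ~ d
      de : d ~ e
      ea : e ~ a
      a≢c : a ≢ c
      b≢d : b ≢ d
      c≢e : c ≢ e
      d≢a : d ≢ a
      e≢b : e ≢ b

  rotate₅ : ∀ {a b c d e} → Pentagon a b c d e → Pentagon b c d e a
  rotate₅ (pentagon ab bc cd de ea a≢c b≢d c≢e d≢a e≢b) =
    pentagon bc cd de ea ab b≢d c≢e d≢a e≢b a≢c

  module _ (claw-free : Free claw G) where

    claw-closure : ∀ {c x y z} → c ~ x → c ~ y → c ~ z → x ≢ y → x ≢ z → y ≢ z →
                   x ≁ y → x ≁ z → y ~ z
    claw-closure {c} {x} {y} {z} cx cy cz x≢y x≢z y≢z x≁y x≁z with y ~? z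
    ... | yes yz = yz
    ... | no y≁z =
      contradiction (embed₄ claw distinct cx cy cz (¬-not x≁y) (¬-not x≁z) (¬-not y≁z)) claw-free
      where
      distinct : Unique (c ∷ x ∷ y ∷ z ∷ [])
      distinct = (~⇒≢ cx ∷ ~⇒≢ cy ∷ ~⇒≢ cz ∷ []) ∷ (x≢y ∷ x≢z ∷ []) ∷ (y≢z ∷ []) ∷ [] ∷ []

  module _ (P4-free : Free P4 G) where

    P4-chord : ∀ {a b c d} → a ~ b → b ~ c → c ~ d → a ~ c ⊎ b ~ d ⊎ a ~ d
    P4-chord {a} {b} {c} {d} ab bc cd with a ~? c | b ~? d | a ~? d
    ... | yes ac | _      | _      = inj₁ ac
    ... | no _   | yes bd | _      = inj₂ (inj₁ bd)
    ... | no _   | no _   | yes ad = inj₂ (inj₂ ad)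
    ... | no a≁c | no b≁d | no a≁d =
      contradiction (embed₄ P4 distinct ab (¬-not a≁c) (¬-not a≁d) bc (¬-not b≁d) cd) P4-free
      where
      distinct : Unique (a ∷ b ∷ c ∷ d ∷ [])
      distinct = (~⇒≢ ab ∷ ≢-sym (~≁⇒≢ cd a≁d) ∷ ~≁⇒≢ ab (≁-sym b≁d) ∷ [])
               ∷ (~⇒≢ bc ∷ ~≁⇒≢ (~-sym ab) (≁-sym a≁d) ∷ []) ∷ (~⇒≢ cd ∷ []) ∷ [] ∷ []

    long-loop⇒chorded : ∀ {a vs} → Loop a vs → Unique (a ∷ vs) → 5 ≤ suc (length vs) →
                        ChordedCycle G (suc (length vs))
    long-loop⇒chorded C@(close (step ab (step bc (step cd _))) _) u 5≤m with P4-chord ab bc cd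
    ... | inj₁ ac        = loop⇒chordedCycle C u 0F 2F ≤-refl (<⇒≤ 5≤m) ac
    ... | inj₂ (inj₁ bd) = loop⇒chordedCycle C u 1F 3F ≤-refl 5≤m bd
    ... | inj₂ (inj₂ ad) = loop⇒chordedCycle C u 0F 3F (n≤1+n 2) 5≤m ad
    long-loop⇒chorded (close stop _) _ (s≤s ())
    long-loop⇒chorded (close (step _ stop) _) _ (s≤s (s≤s ()))
    long-loop⇒chorded (close (step _ (step _ stop)) _) _ (s≤s (s≤s (s≤s ())))

    long-cycle⇒chorded : ∀ {m} → 5 ≤ m → ListCycle m → ChordedCycle G m
    long-cycle⇒chorded 5≤m (cycle C u refl) = long-loop⇒chorded C u 5≤m

    chorded-pentagon⇒diamond : ∀ {a b c d e} → Pentagon a b c d e → a ~ c → ChordedCycle G 4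
    chorded-pentagon⇒diamond (pentagon ab bc cd de ea _ _ c≢e d≢a _) ac with P4-chord bc cd de
    ... | inj₁ bd        = diamond bd (~-sym cd) (~-sym ac) ab d≢a bc
    ... | inj₂ (inj₁ ce) = diamond cd de ea ac d≢a ce
    ... | inj₂ (inj₂ be) = diamond ac (~-sym bc) be ea c≢e ab

    pentagon⇒diamond : ∀ {a b c d e} → Pentagon a b c d e → ChordedCycle G 4
    pentagon⇒diamond P@(pentagon ab bc cd _ _ _ _ _ _ _) with P4-chord ab bc cd
    ... | inj₁ ac        = chorded-pentagon⇒diamond P ac
    ... | inj₂ (inj₁ bd) = chorded-pentagon⇒diamond (rotate₅ P) bd
    ... | inj₂ (inj₂ ad) = chorded-pentagon⇒diamond (rotate₅ (rotate₅ (rotate₅ P))) (~-sym ad)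

    cycle₅⇒chorded₄ : ListCycle 5 → ChordedCycle G 4
    cycle₅⇒chorded₄ (cycle (close (step ab (step bc (step cd (step de stop)))) ea)
                           ((_ ∷ a≢c ∷ a≢d ∷ _ ∷ []) ∷ (_ ∷ b≢d ∷ b≢e ∷ []) ∷ (_ ∷ c≢e ∷ []) ∷ _)
                           refl) =
      pentagon⇒diamond (pentagon ab bc cd de ea a≢c b≢d c≢e (≢-sym a≢d) (≢-sym b≢e))
    cycle₅⇒chorded₄ (cycle (close stop _) _ ())
    cycle₅⇒chorded₄ (cycle (close (step _ stop) _) _ ())
    cycle₅⇒chorded₄ (cycle (close (step _ (step _ stop)) _) _ ())
    cycle₅⇒chorded₄ (cycle (close (step _ (step _ (step _ stop))) _) _ ())
    cycle₅⇒chorded₄ (cycle (close (step _ (step _ (step _ (step _ (step _ _))))) _) _ ())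

    fan-or-insert : ∀ {x v a vs b} → x ~ v → v ~ a → x ≁ a → Walk a vs b →
                    All (v ~_) vs × All (x ≁_) vs ⊎ Σ[ us ∈ List V ] Walk a us b × us ↭ x ∷ v ∷ vs
    fan-or-insert xv va x≁a stop = inj₁ ([] , [])
    fan-or-insert {x} {v} xv va x≁a (step {b = d} ad w) with x ~? d
    ... | yes xd = inj₂ (_ , step (~-sym va) (step (~-sym xv) (step xd w)) , swap v x ↭-refl)
    ... | no x≁d with P4-chord xv va ad
    ...   | inj₁ xa        = contradiction xa x≁a
    ...   | inj₂ (inj₂ xd) = contradiction xd x≁d
    ...   | inj₂ (inj₁ vd) with fan-or-insert xv vd x≁d w
    ...     | inj₁ (v~vs , x≁vs) = inj₁ (vd ∷ v~vs , x≁d ∷ x≁vs)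
    ...     | inj₂ (us , w′ , p) =
      inj₂ (d ∷ us , step ad w′ , ↭-trans (prep d p) (↭-sym (shift d (x ∷ v ∷ []) _)))

    module _ (2conn : TwoConnected G) where

      private
        3≤n : 3 ≤ n
        3≤n = proj₁ 2conn
        connected : Connected G
        connected = proj₁ (proj₂ 2conn)
        avoiding : ∀ v u w → u ≢ v → w ≢ v → WalkIn G (_≢ v) u w
        avoiding = proj₂ (proj₂ 2conn)

      triangle-or-square : ∀ {u w x} → u ~ w → x ~ u → x ∉ u ∷ w ∷ [] → ListCycle 3 ⊎ ListCycle 4
      triangle-or-square {u} {w} {x} uw xu x∉ with x ~? w
      ... | yes xw = inj₁ (triangle uw (~-sym xw) xu)
      ... | no x≁w
        with first-crossing (u ∷ w ∷ []) (avoiding u x w (~⇒≢ xu) (≢-sym (~⇒≢ uw)))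
                            x∉ (there (here refl))
      ... | crossing _ (here refl) _ t≢u = contradiction refl t≢u
      ... | crossing _ (there (there ())) _ _
      ... | crossing y∉ (there (here refl)) yw _ with P4-chord xu uw (~-sym yw)
      ...   | inj₁ xw        = contradiction xw x≁w
      ...   | inj₂ (inj₁ uy) = inj₁ (triangle uw (~-sym yw) (~-sym uy))
      ...   | inj₂ (inj₂ xy) =
        inj₂ (square xu uw (~-sym yw) (~-sym xy) (λ x≡w → x∉ (there (here x≡w)))
                                                 (λ u≡y → y∉ (here (≡.sym u≡y))))

      short-cycle : ListCycle 3 ⊎ ListCycle 4
      short-cycle with length<⇒∃∉ [] (≤-trans (s≤s z≤n) 3≤n)
      ... | u , _ with length<⇒∃∉ [ u ] (≤-trans (s≤s (s≤s z≤n)) 3≤n)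
      ... | z₁ , z₁∉ with first-crossing [ u ] (connected z₁ u) z₁∉ (here refl)
      ... | crossing _ (there ()) _ _
      ... | crossing {w} _ (here refl) wu _ with length<⇒∃∉ (u ∷ w ∷ []) 3≤n
      ... | z , z∉ with first-crossing (u ∷ w ∷ []) (connected z u) z∉ (here refl)
      ... | crossing x∉ (here refl) xu _         = triangle-or-square (~-sym wu) xu x∉
      ... | crossing x∉ (there (here refl)) xw _ =
        triangle-or-square wu xw (∉-resp-↭ (swap u w ↭-refl) x∉)
      ... | crossing _ (there (there ())) _ _

      module _ (claw-free : Free claw G) where

        insert-or-wheel : ∀ {x v ws} → x ~ v → x ∉ v ∷ ws → Unique (v ∷ ws) → 2 ≤ length ws →
                          Loop v ws → Tour (x ∷ v ∷ ws) ⊎ Wheel v ws × All (x ≁_) ws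
        insert-or-wheel {x} {v} xv x∉ (_ ∷ w₁∉ ∷ _) _
                        (close {b} (step {b = w₁} vw₁ w@(step _ w′)) bv) with x ~? w₁
        ... | yes xw₁ = inj₁ (v , _ , close (step (~-sym xv) (step xw₁ w)) bv , swap v x ↭-refl)
        ... | no x≁w₁ with x ~? b
        ...   | yes xb = inj₁ (v , _ , close (append (step vw₁ w) (~-sym xb) stop) xv ,
                               ↭-sym (∷↭∷ʳ x (v ∷ w₁ ∷ _)))
        ...   | no x≁b with claw-closure claw-free (~-sym xv) vw₁ (~-sym bv) x≢w₁ x≢b w₁≢b x≁w₁ x≁b
                          | fan-or-insert xv vw₁ x≁w₁ w
          where
          x≢w₁ : x ≢ w₁
          x≢w₁ x≡w₁ = x∉ (there (here x≡w₁))
          x≢b : x ≢ b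
          x≢b refl = x∉ (there (last∈ w))
          w₁≢b : w₁ ≢ b
          w₁≢b = All.lookup w₁∉ (last∈ w′)
        ...     | w₁b | inj₁ (v~ws , x≁ws) =
          inj₂ (((w₁ , _ , close w (~-sym w₁b) , ↭-refl) , vw₁ ∷ v~ws) , x≁w₁ ∷ x≁ws)
        ...     | w₁b | inj₂ (us , w″ , p) =
          inj₁ (w₁ , us , close w″ (~-sym w₁b) , ↭-trans (prep w₁ p) (↭-sym (shift w₁ (x ∷ v ∷ []) _)))
        insert-or-wheel _ _ _ () (close stop _)
        insert-or-wheel _ _ _ (s≤s ()) (close (step _ stop) _)

        around-wheel : ∀ {x v ws} → x ~ v → x ∉ v ∷ ws → Unique (v ∷ ws) → 2 ≤ length ws →
                       Loop v ws → Wheel v ws → All (x ≁_) ws → ListCycle (suc (length (v ∷ ws)))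
        around-wheel {ws = []} _ _ _ () _ _ _
        around-wheel {x} {v} {w₁ ∷ _} xv x∉ u@((v≢w₁ ∷ _) ∷ _) 2≤ C W@(_ , spokes) x≁ws
          with first-crossing (v ∷ w₁ ∷ _) (avoiding v x w₁ (~⇒≢ xv) (≢-sym v≢w₁))
                              x∉ (there (here refl))
        ... | crossing _ (here refl) _ t≢v = contradiction refl t≢v
        ... | crossing {y} {t} y∉ (there t∈) yt t≢v with rotate C (there t∈)
        ... | ws₂ , C₂ , p
          with insert-or-wheel yt (∉-resp-↭ (↭-sym p) y∉) (Unique-resp-↭ (↭-sym p) u)
                               (subst (2 ≤_) (suc-injective (≡.sym (↭-length p))) 2≤) C₂
        ... | inj₁ T = Tour⇒ListCycle (Tour-resp-↭ (prep y p) T) (fresh∷ y∉ u) refl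
        ... | inj₂ (_ , y≁ws₂) with P4-chord xv (All.lookup spokes t∈) (~-sym yt)
        ...   | inj₁ xt        = contradiction xt (All.lookup x≁ws t∈)
        ...   | inj₂ (inj₁ vy) = contradiction (~-sym vy) (All.lookup y≁ws₂ v∈ws₂)
          where
          v∈ws₂ : v ∈ ws₂
          v∈ws₂ with ∈-resp-↭ (↭-sym p) (here refl)
          ... | here v≡t = contradiction (≡.sym v≡t) t≢v
          ... | there v∈ = v∈
        ...   | inj₂ (inj₂ xy) = wheel-detour W t∈ 2≤ u (~-sym xv) xy yt x∉ y∉

        extend-at : ∀ {x v ws} → x ~ v → x ∉ v ∷ ws → Unique (v ∷ ws) → 2 ≤ length ws →
                    Loop v ws → ListCycle (suc (length (v ∷ ws)))
        extend-at xv x∉ u 2≤ C with insert-or-wheel xv x∉ u 2≤ C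
        ... | inj₁ T          = Tour⇒ListCycle T (fresh∷ x∉ u) refl
        ... | inj₂ (W , x≁ws) = around-wheel xv x∉ u 2≤ C W x≁ws

        extend : ∀ {m} → ListCycle m → 3 ≤ m → m < n → ListCycle (suc m)
        extend (cycle {r} {vs} C u refl) 3≤m m<n with length<⇒∃∉ (r ∷ vs) m<n
        ... | x₀ , x₀∉ with first-crossing (r ∷ vs) (connected x₀ r) x₀∉ (here refl)
        ... | crossing x∉ v∈ xv _ with rotate C v∈
        ... | ws , C′ , p =
          subst (λ k → ListCycle (suc k)) (↭-length p)
                (extend-at xv (∉-resp-↭ (↭-sym p) x∉) (Unique-resp-↭ (↭-sym p) u)
                           (subst (2 ≤_) (suc-injective (≡.sym (↭-length p))) (≤-pred 3≤m)) C′)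

        grow : ∀ {k} m → 3 ≤ k → k ≤ m → m ≤ n → ListCycle k → ListCycle m
        grow m 3≤k k≤m m≤n C with m≤n⇒m<n∨m≡n k≤m
        ... | inj₂ refl = C
        grow zero    _   _ _   _ | inj₁ ()
        grow (suc m) 3≤k _ m<n C | inj₁ (s≤s k≤m) =
          extend (grow m 3≤k k≤m (<⇒≤ m<n) C) (≤-trans 3≤k k≤m) m<n

        cycle-of-length : ∀ m → 4 ≤ m → m ≤ n → ListCycle m
        cycle-of-length m 4≤m m≤n with short-cycle
        ... | inj₁ C₃ = grow m ≤-refl (<⇒≤ 4≤m) m≤n C₃
        ... | inj₂ C₄ = grow m (n≤1+n 3) 4≤m m≤n C₄

theorem8 : (n : ℕ) → 5 ≤ n → (G : Graph n) → TwoConnected G →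
    Free claw G → Free P4 G → ChordedPancyclic G
theorem8 n 5≤n G 2conn claw-free P4-free m 4≤m m≤n = chorded (m≤n⇒m<n∨m≡n 4≤m)
  where
  cycles : ∀ k → 4 ≤ k → k ≤ n → ListCycle G k
  cycles = cycle-of-length G P4-free 2conn claw-free
  chorded : 4 < m ⊎ 4 ≡ m → ChordedCycle G m
  chorded (inj₁ 5≤m)  = long-cycle⇒chorded G P4-free 5≤m (cycles m 4≤m m≤n)
  chorded (inj₂ refl) = cycle₅⇒chorded₄ G P4-free (cycles 5 (n≤1+n 4) 5≤n)
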